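{- Let $V$ be a finite vector space over $\mathbb{F}_3$ with $\dim V\ge 3$. Every sum-free set $A\subseteq V$ with $|A|>\frac16|V|$ contains a line, i.e. a one-dimensional affine subspace of $V$.
   Context: Sum-free: there are no $x,y,z\in A$ (not necessarily distinct) with $x+y=z$. -}

module Defs where

open import Data.Nat using (ℕ)
open import Data.Fin using (Fin; zero; suc)
open import Data.Vec using (Vec; zipWith; replicate)
open import Data.List using (List)
open import Data.List.Membership.Propositional using (_∈_; _∉_)
open import Data.List.Relation.Unary.Unique.Propositional using (Unique)
open import Data.Product using (∃₂; _×_)
open import Relation.Binary.PropositionalEquality using (_≢_)

F₃ : Set
F₃ = Fin 3

_+₃_ : F₃ → F₃ → F₃
zero +₃ y = y
suc zero +₃ zero = suc zero
suc zero +₃ suc zero = suc (suc zero)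
suc zero +₃ suc (suc zero) = zero
suc (suc zero) +₃ zero = suc (suc zero)
suc (suc zero) +₃ suc zero = zero
suc (suc zero) +₃ suc (suc zero) = suc zero

V : ℕ → Set
V n = Vec F₃ n

_⊕_ : ∀ {n} → V n → V n → V n
_⊕_ = zipWith _+₃_

𝟎 : ∀ {n} → V n
𝟎 = replicate _ zero

-- A finite subset of V n is given by a duplicate-free list of its elements;
-- its cardinality is the length of the list.

SumFree : ∀ {n} → List (V n) → Set
SumFree A = ∀ {x y} → x ∈ A → y ∈ A → (x ⊕ y) ∉ A

ContainsLine : ∀ {n} → List (V n) → Set
ContainsLine A = ∃₂ λ a d → d ≢ 𝟎 × (a ∈ A) × ((a ⊕ d) ∈ A) × (((a ⊕ d) ⊕ d) ∈ A)

-- Let A ⊆ F₃ⁿ be sum-free and line-free, and fix a ∈ A. Sum-freeness gives A ∩ −A = ∅, and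
-- together with line-freeness it forces every coset of F₃ a other than F₃ a itself to meet
-- A ∪ −A in at most one point. Hence A ∪ −A meets at least 2|A| − 1 of the 3ⁿ⁻¹ cosets.
-- A case analysis in the span of a and two further points b, c of A shows that one of the
-- cosets b ± c + F₃ a misses A ∪ −A, so 2|A| ≤ 3ⁿ⁻¹, i.e. |A| ≤ 3ⁿ/6. As containing a line
-- is decidable, a larger sum-free set therefore contains one.

module Submission where

open import Defs
open import Data.Nat using (ℕ; suc; _+_; _*_; _^_; _≤_; _<_; z≤n; s≤s)
import Data.Nat.Properties as ℕ
open import Data.Nat.Tactic.RingSolver using (solve-∀)
open import Data.Fin using (Fin; zero; suc; combine)
open import Data.Fin.Properties using (all?; combine-injective; injective⇒≤)
  renaming (_≟_ to _≟₃_)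
open import Data.Vec using (Vec; []; _∷_; map; lookup)
open import Data.Vec.Properties
  using (zipWith-comm; zipWith-identityˡ; zipWith-identityʳ; map-id; map-const)
import Data.Vec.Properties as Vec
import Data.List as List
open import Data.List using (List; []; _∷_; _++_; length)
import Data.List.Properties as List
open import Data.List.Membership.Propositional using (_∈_; _∉_; lose)
open import Data.List.Membership.Propositional.Properties using (∈-lookup)
open import Data.List.Relation.Unary.Any as Any using (Any; here; there; any?; satisfied)
import Data.List.Relation.Unary.Any.Properties as Any
open import Data.List.Relation.Unary.All as All using (All; []; _∷_)
import Data.List.Relation.Unary.All.Properties as All
open import Data.List.Relation.Unary.AllPairs as AllPairs using (AllPairs; []; _∷_)
import Data.List.Relation.Unary.AllPairs.Properties as AllPairs
open import Data.List.Relation.Binary.Disjoint.Propositional using (Disjoint)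
open import Data.List.Relation.Unary.Unique.Propositional using (Unique)
import Data.List.Relation.Unary.Unique.Propositional.Properties as Unique
open import Data.Product using (∃; _×_; _,_; proj₂)
open import Data.Sum using (_⊎_; inj₁; inj₂)
open import Data.Empty using (⊥)
open import Relation.Nullary using (¬_; Dec; yes; no; contradiction)
open import Relation.Nullary.Decidable
  using (from-yes; ¬?; _×-dec_; _⊎-dec_; map′; decidable-stable)
open import Relation.Binary.PropositionalEquality
open import Relation.Binary.Definitions using (DecidableEquality)
open ≡-Reasoning

_·₃_ : F₃ → F₃ → F₃
zero ·₃ y = zero
suc zero ·₃ y = y
suc (suc zero) ·₃ y = y +₃ y

+₃-comm : ∀ x y → x +₃ y ≡ y +₃ x
+₃-comm = from-yes (all? λ x → all? λ y → x +₃ y ≟₃ y +₃ x)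

+₃-identityʳ : ∀ x → x +₃ zero ≡ x
+₃-identityʳ = from-yes (all? λ x → x +₃ zero ≟₃ x)

+₃-thrice : ∀ x y → ((x +₃ y) +₃ y) +₃ y ≡ x
+₃-thrice = from-yes (all? λ x → all? λ y → ((x +₃ y) +₃ y) +₃ y ≟₃ x)

+₃-neg-cancel : ∀ x y → x +₃ ((x +₃ x) +₃ y) ≡ y
+₃-neg-cancel = from-yes (all? λ x → all? λ y → x +₃ ((x +₃ x) +₃ y) ≟₃ y)

double-+₃ : ∀ x y → (x +₃ y) +₃ (x +₃ y) ≡ ((x +₃ x) +₃ y) +₃ y
double-+₃ = from-yes (all? λ x → all? λ y → (x +₃ y) +₃ (x +₃ y) ≟₃ ((x +₃ x) +₃ y) +₃ y)

+₃-interchange : ∀ x y z w → (x +₃ y) +₃ (z +₃ w) ≡ (x +₃ z) +₃ (y +₃ w)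
+₃-interchange = from-yes (all? λ x → all? λ y → all? λ z → all? λ w →
  (x +₃ y) +₃ (z +₃ w) ≟₃ (x +₃ z) +₃ (y +₃ w))

·₃-distribʳ : ∀ s t x → (s +₃ t) ·₃ x ≡ (s ·₃ x) +₃ (t ·₃ x)
·₃-distribʳ = from-yes (all? λ s → all? λ t → all? λ x → (s +₃ t) ·₃ x ≟₃ (s ·₃ x) +₃ (t ·₃ x))

-- −u = 2u in characteristic 3.
neg : ∀ {n} → V n → V n
neg u = u ⊕ u

_·_ : ∀ {n} → F₃ → V n → V n
s · u = map (s ·₃_) u

⊕-comm : ∀ {n} (u v : V n) → u ⊕ v ≡ v ⊕ u
⊕-comm = zipWith-comm +₃-comm

⊕-identityˡ : ∀ {n} (u : V n) → 𝟎 ⊕ u ≡ u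
⊕-identityˡ = zipWith-identityˡ (λ _ → refl)

⊕-identityʳ : ∀ {n} (u : V n) → u ⊕ 𝟎 ≡ u
⊕-identityʳ = zipWith-identityʳ +₃-identityʳ

⊕-thrice : ∀ {n} (u d : V n) → ((u ⊕ d) ⊕ d) ⊕ d ≡ u
⊕-thrice []      []      = refl
⊕-thrice (x ∷ u) (y ∷ d) = cong₂ _∷_ (+₃-thrice x y) (⊕-thrice u d)

⊕-neg-cancel : ∀ {n} (u d : V n) → u ⊕ (neg u ⊕ d) ≡ d
⊕-neg-cancel []      []      = refl
⊕-neg-cancel (x ∷ u) (y ∷ d) = cong₂ _∷_ (+₃-neg-cancel x y) (⊕-neg-cancel u d)

neg-⊕ : ∀ {n} (u d : V n) → neg (u ⊕ d) ≡ (neg u ⊕ d) ⊕ d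
neg-⊕ []      []      = refl
neg-⊕ (x ∷ u) (y ∷ d) = cong₂ _∷_ (double-+₃ x y) (neg-⊕ u d)

⊕-interchange : ∀ {n} (u v w z : V n) → (u ⊕ v) ⊕ (w ⊕ z) ≡ (u ⊕ w) ⊕ (v ⊕ z)
⊕-interchange []      []      []      []      = refl
⊕-interchange (x ∷ u) (y ∷ v) (z ∷ w) (t ∷ s) =
  cong₂ _∷_ (+₃-interchange x y z t) (⊕-interchange u v w s)

·-distribʳ : ∀ {n} s t (u : V n) → (s +₃ t) · u ≡ (s · u) ⊕ (t · u)
·-distribʳ s t []      = refl
·-distribʳ s t (x ∷ u) = cong₂ _∷_ (·₃-distribʳ s t x) (·-distribʳ s t u)

·-zero : ∀ {n} (u : V n) → zero · u ≡ 𝟎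
·-zero u = map-const u zero

·-one : ∀ {n} (u : V n) → suc zero · u ≡ u
·-one = map-id

neg-involutive : ∀ {n} (u : V n) → neg (neg u) ≡ u
neg-involutive u = trans (neg-⊕ u u) (⊕-thrice u u)

neg-⊕-cancel : ∀ {n} (u d : V n) → neg u ⊕ (u ⊕ d) ≡ d
neg-⊕-cancel u d = begin
  neg u ⊕ (u ⊕ d)             ≡⟨ cong (λ v → neg u ⊕ (v ⊕ d)) (neg-involutive u) ⟨
  neg u ⊕ (neg (neg u) ⊕ d)   ≡⟨ ⊕-neg-cancel (neg u) d ⟩
  d                           ∎

⊕-cancelˡ : ∀ {n} (u : V n) {d e} → u ⊕ d ≡ u ⊕ e → d ≡ e
⊕-cancelˡ u {d} {e} eq = begin
  d                 ≡⟨ neg-⊕-cancel u d ⟨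
  neg u ⊕ (u ⊕ d)   ≡⟨ cong (neg u ⊕_) eq ⟩
  neg u ⊕ (u ⊕ e)   ≡⟨ neg-⊕-cancel u e ⟩
  e                 ∎

⊕-identityʳ-unique : ∀ {n} (u d : V n) → u ⊕ d ≡ u → d ≡ 𝟎
⊕-identityʳ-unique u d eq = ⊕-cancelˡ u (trans eq (sym (⊕-identityʳ u)))

-- As a set, line u d is the coset u + F₃ d.
line : ∀ {n} → V n → V n → List (V n)
line u d = u ∷ u ⊕ d ∷ (u ⊕ d) ⊕ d ∷ []

module _ {n : ℕ} {d : V n} where

  line-step : ∀ {u w} → w ∈ line u d → w ⊕ d ∈ line u d
  line-step     (here refl)                 = there (here refl)
  line-step     (there (here refl))         = there (there (here refl))
  line-step {u} (there (there (here refl))) = here (⊕-thrice u d)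

  line-sym : ∀ {u w} → w ∈ line u d → u ∈ line w d
  line-sym     (here refl)                 = here refl
  line-sym {u} (there (here refl))         = there (there (here (sym (⊕-thrice u d))))
  line-sym {u} (there (there (here refl))) = there (here (sym (⊕-thrice u d)))

  line-trans : ∀ {u v w} → v ∈ line w d → w ∈ line u d → v ∈ line u d
  line-trans (here refl)                 w∈ = w∈
  line-trans (there (here refl))         w∈ = line-step w∈
  line-trans (there (there (here refl))) w∈ = line-step (line-step w∈)

  line-unique : d ≢ 𝟎 → ∀ u → Unique (line u d)
  line-unique d≢𝟎 u = (v≢v⊕d u ∷ u≢u⊕d⊕d ∷ []) ∷ (v≢v⊕d (u ⊕ d) ∷ []) ∷ [] ∷ []
    where
    v≢v⊕d : ∀ v → v ≢ v ⊕ d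
    v≢v⊕d v eq = d≢𝟎 (⊕-identityʳ-unique v d (sym eq))
    u≢u⊕d⊕d : u ≢ (u ⊕ d) ⊕ d
    u≢u⊕d⊕d eq = d≢𝟎 (⊕-identityʳ-unique u d (trans (cong (_⊕ d) eq) (⊕-thrice u d)))

  line-disjoint : ∀ {u v} → v ∉ line u d → Disjoint (line u d) (line v d)
  line-disjoint v∉ (w∈u , w∈v) = v∉ (line-trans (line-sym w∈v) w∈u)

neg-⊕² : ∀ {n} (u d : V n) → neg ((u ⊕ d) ⊕ d) ≡ neg u ⊕ d
neg-⊕² u d = begin
  neg ((u ⊕ d) ⊕ d)                 ≡⟨ neg-⊕ (u ⊕ d) d ⟩
  (neg (u ⊕ d) ⊕ d) ⊕ d             ≡⟨ cong (λ v → (v ⊕ d) ⊕ d) (neg-⊕ u d) ⟩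
  (((neg u ⊕ d) ⊕ d) ⊕ d) ⊕ d       ≡⟨ cong (_⊕ d) (⊕-thrice (neg u) d) ⟩
  neg u ⊕ d                         ∎

neg-line : ∀ {n} {u d w : V n} → w ∈ line u d → neg w ∈ line (neg u) d
neg-line                 (here refl)                 = here refl
neg-line {u = u} {d = d} (there (here refl))         = there (there (here (neg-⊕ u d)))
neg-line {u = u} {d = d} (there (there (here refl))) = there (here (neg-⊕² u d))

encode : ∀ {n} → V n → Fin (3 ^ n)
encode []      = zero
encode (x ∷ u) = combine x (encode u)

encode-injective : ∀ {n} (u v : V n) → encode u ≡ encode v → u ≡ v
encode-injective []      []      _  = refl
encode-injective (x ∷ u) (y ∷ v) eq with combine-injective x (encode u) y (encode v) eq
... | refl , eq′ = cong (x ∷_) (encode-injective u v eq′)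

lookup-injective : ∀ {A : Set} {xs : List A} → Unique xs →
                   ∀ i j → List.lookup xs i ≡ List.lookup xs j → i ≡ j
lookup-injective (_   ∷ _) zero    zero    _  = refl
lookup-injective (x≢ ∷ _) zero    (suc j) eq = contradiction eq (All.lookup x≢ (∈-lookup j))
lookup-injective (x≢ ∷ _) (suc i) zero    eq = contradiction (sym eq) (All.lookup x≢ (∈-lookup i))
lookup-injective (_   ∷ u) (suc i) (suc j) eq = cong suc (lookup-injective u i j eq)

unique-length≤ : ∀ {n} {xs : List (V n)} → Unique xs → length xs ≤ 3 ^ n
unique-length≤ {xs = xs} unique = injective⇒≤ {f = λ i → encode (List.lookup xs i)}
  λ {i} {j} eq → lookup-injective unique i j (encode-injective _ _ eq)

length-lines : ∀ {n} (d : V n) X → length (List.concatMap (λ u → line u d) X) ≡ 3 * length X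
length-lines d []      = refl
length-lines d (u ∷ X) = trans (cong (3 +_) (length-lines d X)) (sym (ℕ.*-suc 3 (length X)))

distinct-cosets-bound : ∀ {n} {d : V n} → d ≢ 𝟎 → ∀ X →
  AllPairs (λ u v → v ∉ line u d) X → 3 * length X ≤ 3 ^ n
distinct-cosets-bound {d = d} d≢𝟎 X apart = subst (_≤ _) (length-lines d X)
  (unique-length≤ (Unique.concat⁺ (All.map⁺ (All.universal (line-unique d≢𝟎) X))
                                  (AllPairs.map⁺ (AllPairs.map line-disjoint apart))))

_∈±_ : ∀ {n} → V n → List (V n) → Set
x ∈± A = x ∈ A ⊎ neg x ∈ A

_∉±_ : ∀ {n} → V n → List (V n) → Set
x ∉± A = ¬ x ∈± A

module SumFreeLineFree {n} {A : List (V n)} (sum-free : SumFree A) (line-free : ¬ ContainsLine A)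
  where

  𝟎∉A : 𝟎 ∉ A
  𝟎∉A 𝟎∈A = sum-free 𝟎∈A 𝟎∈A (subst (_∈ A) (sym (⊕-identityˡ 𝟎)) 𝟎∈A)

  zero-sum-triple : ∀ {p q} → p ∈ A → q ∈ A → p ≢ q → neg (p ⊕ q) ∉ A
  zero-sum-triple {p} {q} p∈A q∈A p≢q r∈A =
    line-free (p , d , d≢𝟎 , p∈A , subst (_∈ A) (sym p⊕d≡q) q∈A , subst (_∈ A) (sym p⊕d⊕d≡r) r∈A)
    where
    d : V n
    d = neg p ⊕ q
    p⊕d≡q : p ⊕ d ≡ q
    p⊕d≡q = ⊕-neg-cancel p q
    d≢𝟎 : d ≢ 𝟎
    d≢𝟎 d≡𝟎 = p≢q (trans (sym (⊕-identityʳ p)) (trans (cong (p ⊕_) (sym d≡𝟎)) p⊕d≡q))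
    p⊕d⊕d≡r : (p ⊕ d) ⊕ d ≡ neg (p ⊕ q)
    p⊕d⊕d≡r = begin
      (p ⊕ d) ⊕ d   ≡⟨ cong (_⊕ d) p⊕d≡q ⟩
      q ⊕ d         ≡⟨ ⊕-comm q d ⟩
      d ⊕ q         ≡⟨ neg-⊕ p q ⟨
      neg (p ⊕ q)   ∎

  module _ {a : V n} (a∈A : a ∈ A) where

    coset-unique : ∀ {u v} → u ∈ A → v ∈ A → v ∈ line u a → v ≡ u
    coset-unique     _   _   (here v≡u)                  = v≡u
    coset-unique     u∈A v∈A (there (here refl))         = contradiction v∈A (sum-free u∈A a∈A)
    coset-unique {u} u∈A v∈A (there (there (here refl))) =
      contradiction (subst (_∈ A) (sym (⊕-thrice u a)) u∈A) (sum-free v∈A a∈A)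

    neg-coset-apart : ∀ {u v} → u ∈ A → v ∈ A → u ≢ a → neg v ∉ line u a
    neg-coset-apart     u∈A v∈A u≢a (here -v≡u) = sum-free v∈A v∈A (subst (_∈ A) (sym -v≡u) u∈A)
    neg-coset-apart {u} {v} u∈A v∈A u≢a (there (here -v≡u⊕a)) =
      zero-sum-triple u∈A a∈A u≢a
        (subst (_∈ A) (trans (sym (neg-involutive v)) (cong neg -v≡u⊕a)) v∈A)
    neg-coset-apart {u} {v} u∈A v∈A u≢a (there (there (here -v≡u⊕a⊕a))) =
      sum-free u∈A v∈A (subst (_∈ A) (sym u⊕v≡a) a∈A)
      where
      u⊕v≡a : u ⊕ v ≡ a
      u⊕v≡a = begin
        u ⊕ v                   ≡⟨ cong (u ⊕_) (neg-involutive v) ⟨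
        u ⊕ neg (neg v)         ≡⟨ cong (λ w → u ⊕ neg w) -v≡u⊕a⊕a ⟩
        u ⊕ neg ((u ⊕ a) ⊕ a)   ≡⟨ cong (u ⊕_) (neg-⊕² u a) ⟩
        u ⊕ (neg u ⊕ a)         ≡⟨ ⊕-neg-cancel u a ⟩
        a                       ∎

avoiding-line⇒bound : ∀ {n} {a y : V n} {rest} → Unique (a ∷ rest) → SumFree (a ∷ rest) →
  ¬ ContainsLine (a ∷ rest) → All (_∉± (a ∷ rest)) (line y a) → 6 * length (a ∷ rest) ≤ 3 ^ n
avoiding-line⇒bound {n} {a} {y} {rest} (a≢rest ∷ unique-rest) sum-free line-free avoids =
  subst (_≤ 3 ^ n) length-reps (distinct-cosets-bound a≢𝟎 reps reps-apart)
  where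
  open SumFreeLineFree sum-free line-free
  A : List (V n)
  A = a ∷ rest

  a∈A : a ∈ A
  a∈A = here refl

  a≢𝟎 : a ≢ 𝟎
  a≢𝟎 a≡𝟎 = 𝟎∉A (subst (_∈ A) a≡𝟎 a∈A)

  Apart : V n → V n → Set
  Apart u v = v ∉ line u a

  -- One point of A ∪ −A from each coset of F₃ a that it meets, plus y.
  reps : List (V n)
  reps = y ∷ A ++ List.map neg rest

  length-reps : 3 * length reps ≡ 6 * length A
  length-reps = begin
    3 * suc (length (A ++ List.map neg rest))
      ≡⟨ cong (λ m → 3 * suc m)
              (trans (List.length-++ A) (cong (length A +_) (List.length-map neg rest))) ⟩
    3 * suc (suc (length rest) + length rest)
      ≡⟨ thrice-twice (length rest) ⟩
    6 * suc (length rest)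
      ∎
    where
    thrice-twice : ∀ r → 3 * suc (suc r + r) ≡ 6 * suc r
    thrice-twice = solve-∀

  apart-of-unique : ∀ {xs} → All (_∈ A) xs → Unique xs → AllPairs Apart xs
  apart-of-unique []            []              = []
  apart-of-unique (x∈A ∷ xs⊆A) (x≢xs ∷ unique) =
    All.zipWith (λ (v∈A , x≢v) v∈ → x≢v (sym (coset-unique a∈A x∈A v∈A v∈))) (xs⊆A , x≢xs)
    ∷ apart-of-unique xs⊆A unique

  rest⊆A : All (_∈ A) rest
  rest⊆A = All.tabulate there

  neg-apart : ∀ {u v} → Apart u v → Apart (neg u) (neg v)
  neg-apart {u} {v} v∉ -v∈ =
    v∉ (subst₂ _∈_ (neg-involutive v) (cong (λ w → line w a) (neg-involutive u)) (neg-line -v∈))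

  a-apart : ∀ {v} → v ∈ rest → Apart a v
  a-apart v∈rest v∈ = All.lookup a≢rest v∈rest (sym (coset-unique a∈A a∈A (there v∈rest) v∈))

  a-apart-neg : ∀ {v} → v ∈ rest → Apart a (neg v)
  a-apart-neg {v} v∈rest -v∈ =
    a-apart v∈rest
      (line-trans (subst (_∈ line (neg a) a) (neg-involutive v) (neg-line -v∈)) (there (here refl)))

  reps-∈± : All (_∈± A) (A ++ List.map neg rest)
  reps-∈± = inj₁ a∈A ∷ All.++⁺ (All.map inj₁ rest⊆A)
    (All.map⁺ (All.tabulate λ {v} v∈rest →
      inj₂ (subst (_∈ A) (sym (neg-involutive v)) (there v∈rest))))

  reps-apart : AllPairs Apart reps
  reps-apart = All.map (λ v± v∈ → All.lookup avoids v∈ v±) reps-∈±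
    ∷ All.++⁺ (All.tabulate a-apart) (All.map⁺ (All.tabulate a-apart-neg))
    ∷ AllPairs.++⁺ rest-apart (AllPairs.map⁺ (AllPairs.map neg-apart rest-apart))
        (All.tabulate λ u∈rest → All.map⁺ (All.tabulate λ v∈rest →
          neg-coset-apart a∈A (there u∈rest) (there v∈rest) (≢-sym (All.lookup a≢rest u∈rest))))
    where
    rest-apart : AllPairs Apart rest
    rest-apart = apart-of-unique rest⊆A unique-rest

combination : ∀ {n k} → Vec (V n) k → V k → V n
combination []       []      = 𝟎
combination (g ∷ gs) (s ∷ u) = (s · g) ⊕ combination gs u

combination-⊕ : ∀ {n k} (gs : Vec (V n) k) u v →
  combination gs (u ⊕ v) ≡ combination gs u ⊕ combination gs v
combination-⊕ []       []      []      = sym (⊕-identityʳ 𝟎)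
combination-⊕ (g ∷ gs) (s ∷ u) (t ∷ v) = begin
  ((s +₃ t) · g) ⊕ combination gs (u ⊕ v)
    ≡⟨ cong₂ _⊕_ (·-distribʳ s t g) (combination-⊕ gs u v) ⟩
  ((s · g) ⊕ (t · g)) ⊕ (combination gs u ⊕ combination gs v)
    ≡⟨ ⊕-interchange (s · g) (t · g) _ _ ⟩
  ((s · g) ⊕ combination gs u) ⊕ ((t · g) ⊕ combination gs v)
    ∎

combination-𝟎 : ∀ {n k} (gs : Vec (V n) k) → combination gs 𝟎 ≡ 𝟎
combination-𝟎 []       = refl
combination-𝟎 (g ∷ gs) = trans (cong₂ _⊕_ (·-zero g) (combination-𝟎 gs)) (⊕-identityʳ 𝟎)

basis : ∀ {k} → Fin k → V k
basis zero    = suc zero ∷ 𝟎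
basis (suc i) = zero ∷ basis i

combination-basis : ∀ {n k} (gs : Vec (V n) k) i → combination gs (basis i) ≡ lookup gs i
combination-basis (g ∷ gs) zero    =
  trans (cong₂ _⊕_ (·-one g) (combination-𝟎 gs)) (⊕-identityʳ g)
combination-basis (g ∷ gs) (suc i) =
  trans (cong₂ _⊕_ (·-zero g) (combination-basis gs i)) (⊕-identityˡ _)

_≟ᵥ_ : ∀ {n} → DecidableEquality (V n)
_≟ᵥ_ = Vec.≡-dec _≟₃_

module _ {n : ℕ} where
  open import Data.List.Membership.DecPropositional (_≟ᵥ_ {n}) using (_∈?_)

  _∈±?_ : ∀ (x : V n) A → Dec (x ∈± A)
  x ∈±? A = (x ∈? A) ⊎-dec (neg x ∈? A)

  containsLine? : ∀ (A : List (V n)) → Dec (ContainsLine A)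
  containsLine? A = map′ from to (any? (λ p → any? (λ q → lineFrom? p (neg p ⊕ q)) A) A)
    where
    LineFrom : V n → V n → Set
    LineFrom p d = d ≢ 𝟎 × p ∈ A × p ⊕ d ∈ A × (p ⊕ d) ⊕ d ∈ A
    lineFrom? : ∀ p d → Dec (LineFrom p d)
    lineFrom? p d = ¬? (d ≟ᵥ 𝟎) ×-dec p ∈? A ×-dec p ⊕ d ∈? A ×-dec (p ⊕ d) ⊕ d ∈? A
    from : Any (λ p → Any (λ q → LineFrom p (neg p ⊕ q)) A) A → ContainsLine A
    from lines with satisfied lines
    ... | p , line-p with satisfied line-p
    ... | q , line-pq = p , neg p ⊕ q , line-pq
    to : ContainsLine A → Any (λ p → Any (λ q → LineFrom p (neg p ⊕ q)) A) A
    to (p , d , line-pd@(_ , p∈A , p⊕d∈A , _)) =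
      lose p∈A (lose p⊕d∈A (subst (LineFrom p) (sym (neg-⊕-cancel p d)) line-pd))

module Span {n} {A : List (V n)} (sum-free : SumFree A) (line-free : ¬ ContainsLine A)
  {a b c : V n} (a∈A : a ∈ A) (b∈A : b ∈ A) (c∈A : c ∈ A) (a≢b : a ≢ b) (a≢c : a ≢ c) (b≢c : b ≢ c)
  where

  ι : V 3 → V n
  ι = combination (a ∷ b ∷ c ∷ [])

  ι-⊕ : ∀ u v → ι (u ⊕ v) ≡ ι u ⊕ ι v
  ι-⊕ = combination-⊕ (a ∷ b ∷ c ∷ [])

  e₁ e₂ e₃ : V 3
  e₁ = basis zero
  e₂ = basis (suc zero)
  e₃ = basis (suc (suc zero))

  -- A record, so that the coordinate vector can be inferred from a membership proof.
  record InA (u : V 3) : Set where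
    constructor ⟨_⟩
    field ι∈A : ι u ∈ A

  InA± : V 3 → Set
  InA± u = InA u ⊎ InA (neg u)

  ι-e₁ : ι e₁ ≡ a
  ι-e₁ = combination-basis (a ∷ b ∷ c ∷ []) zero

  ι-e₂ : ι e₂ ≡ b
  ι-e₂ = combination-basis (a ∷ b ∷ c ∷ []) (suc zero)

  ι-e₃ : ι e₃ ≡ c
  ι-e₃ = combination-basis (a ∷ b ∷ c ∷ []) (suc (suc zero))

  a∈ : InA e₁
  a∈ = ⟨ subst (_∈ A) (sym ι-e₁) a∈A ⟩

  b∈ : InA e₂
  b∈ = ⟨ subst (_∈ A) (sym ι-e₂) b∈A ⟩

  c∈ : InA e₃
  c∈ = ⟨ subst (_∈ A) (sym ι-e₃) c∈A ⟩

  sum-free₃ : ∀ {u v} → InA u → InA v → ¬ InA (u ⊕ v)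
  sum-free₃ {u} {v} ⟨ u∈A ⟩ ⟨ v∈A ⟩ ⟨ u⊕v∈A ⟩ = sum-free u∈A v∈A (subst (_∈ A) (ι-⊕ u v) u⊕v∈A)

  line-free₃ : ∀ {u} d → ι d ≢ 𝟎 → InA u → InA (u ⊕ d) → ¬ InA ((u ⊕ d) ⊕ d)
  line-free₃ {u} d ιd≢𝟎 ⟨ h₀ ⟩ ⟨ h₁ ⟩ ⟨ h₂ ⟩ = line-free
    (ι u , ι d , ιd≢𝟎 , h₀ , subst (_∈ A) (ι-⊕ u d) h₁ ,
     subst (_∈ A) (trans (ι-⊕ (u ⊕ d) d) (cong (_⊕ ι d) (ι-⊕ u d))) h₂)

  ι-nonzero : ∀ u d → ι (u ⊕ d) ≢ ι u → ι d ≢ 𝟎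
  ι-nonzero u d ι[u⊕d]≢ιu ιd≡𝟎 =
    ι[u⊕d]≢ιu (trans (ι-⊕ u d) (trans (cong (ι u ⊕_) ιd≡𝟎) (⊕-identityʳ (ι u))))

  b-a≢𝟎 : ι (e₂ ⊕ neg e₁) ≢ 𝟎
  b-a≢𝟎 = ι-nonzero e₁ (e₂ ⊕ neg e₁) λ eq → a≢b (trans (sym ι-e₁) (trans (sym eq) ι-e₂))

  c-a≢𝟎 : ι (e₃ ⊕ neg e₁) ≢ 𝟎
  c-a≢𝟎 = ι-nonzero e₁ (e₃ ⊕ neg e₁) λ eq → a≢c (trans (sym ι-e₁) (trans (sym eq) ι-e₃))

  c-b≢𝟎 : ι (e₃ ⊕ neg e₂) ≢ 𝟎
  c-b≢𝟎 = ι-nonzero e₂ (e₃ ⊕ neg e₂) λ eq → b≢c (trans (sym ι-e₂) (trans (sym eq) ι-e₃))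

  a+b≢𝟎 : ι (e₁ ⊕ e₂) ≢ 𝟎
  a+b≢𝟎 = ι-nonzero (neg e₁) (e₁ ⊕ e₂) λ eq → sum-free₃ a∈ a∈ ⟨ subst (_∈ A) eq (InA.ι∈A b∈) ⟩

  a+c≢𝟎 : ι (e₁ ⊕ e₃) ≢ 𝟎
  a+c≢𝟎 = ι-nonzero (neg e₁) (e₁ ⊕ e₃) λ eq → sum-free₃ a∈ a∈ ⟨ subst (_∈ A) eq (InA.ι∈A c∈) ⟩

  -- Up to sign, b + c + F₃ a and b − c + F₃ a are the only cosets of F₃ a in span(a, b, c)
  -- that contain none of a, b, c.
  y₁ y₂ : V 3
  y₁ = e₂ ⊕ e₃
  y₂ = e₂ ⊕ neg e₃

  clash : Any InA± (line y₁ e₁) → Any InA± (line y₂ e₁) → ⊥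
  clash (here (inj₁ b+c))  _ = sum-free₃ b∈ c∈ b+c
  clash (here (inj₂ -b-c)) _ = line-free₃ (e₃ ⊕ neg e₂) c-b≢𝟎 b∈ c∈ -b-c
  clash _ (here (inj₁ b-c)) = sum-free₃ c∈ b-c b∈
  clash _ (here (inj₂ c-b)) = sum-free₃ b∈ c-b c∈
  clash (there (here (inj₁ p)))         (there (here (inj₁ q)))         = sum-free₃ c∈ p q
  clash (there (here (inj₁ p)))         (there (here (inj₂ q)))         = line-free₃ (e₁ ⊕ e₂) a+b≢𝟎 c∈ p q
  clash (there (here (inj₁ p)))         (there (there (here (inj₁ q)))) = line-free₃ (e₁ ⊕ e₃) a+c≢𝟎 b∈ p q
  clash (there (here (inj₁ p)))         (there (there (here (inj₂ q)))) = sum-free₃ b∈ p q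
  clash (there (here (inj₂ p)))         (there (here (inj₁ q)))         = sum-free₃ p q c∈
  clash (there (here (inj₂ p)))         (there (here (inj₂ q)))         = sum-free₃ c∈ q p
  clash (there (here (inj₂ p)))         (there (there (here (inj₁ q)))) = sum-free₃ b∈ q p
  clash (there (here (inj₂ p)))         (there (there (here (inj₂ q)))) = sum-free₃ p q b∈
  clash (there (there (here (inj₁ p)))) (there (here (inj₁ q)))         = line-free₃ (e₃ ⊕ neg e₁) c-a≢𝟎 b∈ p q
  clash (there (there (here (inj₁ p)))) (there (here (inj₂ q)))         = sum-free₃ b∈ p q
  clash (there (there (here (inj₁ p)))) (there (there (here (inj₁ q)))) = sum-free₃ c∈ p q
  clash (there (there (here (inj₁ p)))) (there (there (here (inj₂ q)))) = line-free₃ (e₂ ⊕ neg e₁) b-a≢𝟎 c∈ p q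
  clash (there (there (here (inj₂ p)))) (there (here (inj₁ q)))         = sum-free₃ b∈ q p
  clash (there (there (here (inj₂ p)))) (there (here (inj₂ q)))         = sum-free₃ p q b∈
  clash (there (there (here (inj₂ p)))) (there (there (here (inj₁ q)))) = sum-free₃ p q c∈
  clash (there (there (here (inj₂ p)))) (there (there (here (inj₂ q)))) = sum-free₃ c∈ q p

  ι-line : ∀ u d → List.map ι (line u d) ≡ line (ι u) (ι d)
  ι-line u d = cong₂ (λ v w → ι u ∷ v ∷ w ∷ [])
    (ι-⊕ u d) (trans (ι-⊕ (u ⊕ d) d) (cong (_⊕ ι d) (ι-⊕ u d)))

  in-coordinates : ∀ y → Any (_∈± A) (line (ι y) a) → Any InA± (line y e₁)
  in-coordinates y meets = Any.map ±-coordinates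
    (Any.map⁻ (subst (Any (_∈± A)) (sym (trans (ι-line y e₁) (cong (line (ι y)) ι-e₁))) meets))
    where
    ±-coordinates : ∀ {p} → ι p ∈± A → InA± p
    ±-coordinates     (inj₁ p∈A)  = inj₁ ⟨ p∈A ⟩
    ±-coordinates {p} (inj₂ -p∈A) = inj₂ ⟨ subst (_∈ A) (sym (ι-⊕ p p)) -p∈A ⟩

  avoiding-line : ∃ λ y → All (_∉± A) (line y a)
  avoiding-line with any? (_∈±? A) (line (ι y₁) a)
  ... | yes meets₁ = ι y₂ , All.¬Any⇒All¬ _ λ meets₂ →
    clash (in-coordinates y₁ meets₁) (in-coordinates y₂ meets₂)
  ... | no avoids₁ = ι y₁ , All.¬Any⇒All¬ _ avoids₁

small-bound : ∀ {n m} → 3 ≤ n → m ≤ 2 → 6 * m ≤ 3 ^ n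
small-bound 3≤n m≤2 = ℕ.≤-trans (ℕ.*-monoʳ-≤ 6 m≤2) (ℕ.≤-trans (ℕ.m≤m+n 12 15) (ℕ.^-monoʳ-≤ 3 3≤n))

sum-free-line-free-bound : ∀ {n} → 3 ≤ n → (A : List (V n)) →
  Unique A → SumFree A → ¬ ContainsLine A → 6 * length A ≤ 3 ^ n
sum-free-line-free-bound 3≤n []           _ _ _ = small-bound 3≤n z≤n
sum-free-line-free-bound 3≤n (_ ∷ [])     _ _ _ = small-bound 3≤n (s≤s z≤n)
sum-free-line-free-bound 3≤n (_ ∷ _ ∷ []) _ _ _ = small-bound 3≤n (s≤s (s≤s z≤n))
sum-free-line-free-bound _ (a ∷ b ∷ c ∷ rest) unique@((a≢b ∷ a≢c ∷ _) ∷ (b≢c ∷ _) ∷ _)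
                         sum-free line-free =
  avoiding-line⇒bound unique sum-free line-free (proj₂ (Span.avoiding-line sum-free line-free
    (here refl) (there (here refl)) (there (there (here refl))) a≢b a≢c b≢c))

corollary3p8 : (n : ℕ) → 3 ≤ n → (A : List (V n)) → Unique A → SumFree A →
    3 ^ n < 6 * length A → ContainsLine A
corollary3p8 n 3≤n A unique sum-free large = decidable-stable (containsLine? A) λ line-free →
  ℕ.<⇒≱ large (sum-free-line-free-bound 3≤n A unique sum-free line-free)
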